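{- Let $Q_3$ be the $3$-dimensional hypercube with vertex set $\{0,1\}^3$ (two vertices adjacent iff they differ in exactly one coordinate), rooted at $(0,0,0)$. Let $w'$ be the weight function on $Q_3$ defined by $w'(0,0,0)=0$, $w'(1,0,0)=w'(0,1,0)=w'(0,0,1)=2$, $w'(1,1,0)=w'(1,0,1)=w'(0,1,1)=\tfrac43$, and $w'(1,1,1)=1$. Then $w'$ is a valid weight function on $Q_3$ rooted at $(0,0,0)$.
   Context: A configuration on a graph $G$ is a function $p:V(G)\to\mathbb{N}\cup\{0\}$ ($p(v)$ is the number of pebbles on $v$). A pebbling move from a vertex $u$ to an adjacent vertex $v$ removes two pebbles from $u$ and places one pebble on $v$. For a root $r$, a configuration $p$ is $r$-solvable if some (possibly empty) sequence of pebbling moves starting from $p$ places at least one pebble on $r$; otherwise it is $r$-unsolvable. A weight function is a function $w:V(G)\to\mathbb{R}_{\ge 0}$, and the weight of a configuration is $w(p)=\sum_{v\in V(G)}p(v)w(v)$. $1_G$ denotes the configuration with exactly one pebble on every vertex of $G$, so $w(1_G)=\sum_{v\in V(G)}w(v)$. A weight function $w$ on $G$ rooted at $r$ is valid if $r$ is the only vertex with weight $0$ and every $r$-unsolvable configuration $p$ satisfies $w(p)\le w(1_G)$. -}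

module Defs where

open import Data.Bool using (Bool; true; false; if_then_else_)
open import Data.Nat as ℕ using (ℕ; zero; suc; _∸_)
open import Data.Integer using (+_)
open import Data.Rational using (ℚ; _/_; 0ℚ; _≤_) renaming (_+_ to _+ℚ_; _*_ to _*ℚ_)
open import Data.List using (List; []; _∷_; foldr; map)
open import Data.Vec using (Vec; []; _∷_)
open import Data.Product using (Σ; ∃; _×_; _,_)
open import Relation.Nullary using (¬_; Dec; does)
open import Relation.Binary.PropositionalEquality using (_≡_)
open import Relation.Binary.Construct.Closure.ReflexiveTransitive using (Star)

-- A graph is given by a vertex type V with decidable equality,
-- an adjacency relation Adj, and a list `vs` enumerating V(G)
-- (each vertex exactly once) used to form sums over V(G).

Configuration : Set → Set
Configuration V = V → ℕ

module Pebbling {V : Set} (_≟_ : (x y : V) → Dec (x ≡ y))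
                (Adj : V → V → Set) (vs : List V) where

  [_==_] : V → V → ℕ
  [ x == y ] = if does (x ≟ y) then 1 else 0

  Move : Configuration V → Configuration V → Set
  Move p q = Σ V λ u → Σ V λ v → Adj u v × (2 ℕ.≤ p u) ×
             (∀ x → q x ≡ (p x ∸ (2 ℕ.* [ x == u ])) ℕ.+ [ x == v ])

  Reachable : Configuration V → Configuration V → Set
  Reachable = Star Move

  Solvable : V → Configuration V → Set
  Solvable r p = ∃ λ q → Reachable p q × (1 ℕ.≤ q r)

  Unsolvable : V → Configuration V → Set
  Unsolvable r p = ¬ Solvable r p

  ℕtoℚ : ℕ → ℚ
  ℕtoℚ n = + n / 1

  weight : (V → ℚ) → Configuration V → ℚ
  weight w p = foldr _+ℚ_ 0ℚ (map (λ v → ℕtoℚ (p v) *ℚ w v) vs)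

  one : Configuration V
  one _ = 1

  ValidWeight : V → (V → ℚ) → Set
  ValidWeight r w =
    (∀ v → 0ℚ ≤ w v) ×
    (w r ≡ 0ℚ) ×
    (∀ v → w v ≡ 0ℚ → v ≡ r) ×
    (∀ p → Unsolvable r p → weight w p ≤ weight w one)

-- The 3-cube Q₃ with vertex set {0,1}³ (false = 0, true = 1).

Q3 : Set
Q3 = Vec Bool 3

_≟Q3_ : (x y : Q3) → Dec (x ≡ y)
_≟Q3_ = Data.Vec.Properties.≡-dec Data.Bool._≟_
  where import Data.Vec.Properties; import Data.Bool

hamming : ∀ {n} → Vec Bool n → Vec Bool n → ℕ
hamming [] [] = 0
hamming (a ∷ xs) (b ∷ ys) = (if does (a Data.Bool.≟ b) then 0 else 1) ℕ.+ hamming xs ys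
  where import Data.Bool

AdjQ3 : Q3 → Q3 → Set
AdjQ3 x y = hamming x y ≡ 1

verticesQ3 : List Q3
verticesQ3 =
  (false ∷ false ∷ false ∷ []) ∷ (true ∷ false ∷ false ∷ []) ∷
  (false ∷ true ∷ false ∷ []) ∷ (false ∷ false ∷ true ∷ []) ∷
  (true ∷ true ∷ false ∷ []) ∷ (true ∷ false ∷ true ∷ []) ∷
  (false ∷ true ∷ true ∷ []) ∷ (true ∷ true ∷ true ∷ []) ∷ []

rootQ3 : Q3
rootQ3 = false ∷ false ∷ false ∷ []

ones : ∀ {n} → Vec Bool n → ℕ
ones [] = 0
ones (true ∷ xs) = suc (ones xs)
ones (false ∷ xs) = ones xs

w′ : Q3 → ℚ
w′ x with ones x
... | 0 = 0ℚ
... | 1 = + 2 / 1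
... | 2 = + 4 / 3
... | _ = + 1 / 1

open module PebblingQ3 = Pebbling _≟Q3_ AdjQ3 verticesQ3 public

{-# OPTIONS --safe #-}
-- Solvability is upward closed and 2^d pebbles on a vertex at distance d reach the root,
-- so an unsolvable configuration p on Q₃ has p x < 2^|x| at every vertex x: it lies in a
-- box of 1·2³·4³·8 = 4096 configurations.  Every configuration in that box either has
-- weight at most w′(1_G) = 11 or dominates one of sixteen explicit solvable
-- configurations, and this is checked by evaluation.
module Submission where

open import Data.Bool using (Bool; true; false; T)
open import Data.Bool.ListAction using (all)
open import Data.Bool.Properties using (T-≡)
open import Data.Empty using (⊥-elim)
open import Data.Fin using (Fin; zero; suc)
open import Data.List using (List; []; _∷_; foldr; map; upTo; cartesianProduct)
open import Data.List.Membership.Propositional.Properties using (∈-upTo⁺)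
open import Data.List.Relation.Unary.All as All using (All; all?)
open import Data.List.Relation.Unary.All.Properties using (all⁺)
open import Data.List.Relation.Unary.Any using (Any; any?)
open import Data.Maybe using (Maybe; just; nothing; is-just; _<∣>_; to-witness-T)
import Data.Maybe as Maybe
open import Data.Nat using (ℕ; z≤n; _+_; _*_; _∸_; _^_; _≤_; _<_; _≤?_) renaming (_≟_ to _≟ℕ_)
open import Data.Nat.Properties using (≤-trans; ≤-reflexive; ≰⇒>; +-monoˡ-≤; ∸-monoˡ-≤; *-identityʳ; *-zeroʳ)
open import Data.Product using (∃; _×_; _,_)
open import Data.Rational using (0ℚ) renaming (_≤_ to _≤ℚ_; _≤?_ to _≤ℚ?_; _≟_ to _≟ℚ_)
open import Data.Sum using (_⊎_; [_,_]′)
open import Data.Vec using (Vec; []; _∷_; lookup; fromList)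
import Data.Vec as Vec
open import Data.Vec.Properties using (lookup-map)
open import Data.Vec.Relation.Binary.Pointwise.Inductive as Pointwise using (Pointwise; []; _∷_)
open import Data.Vec.Relation.Unary.All.Properties using (lookup⁺; fromList⁺)
open import Function using (_∘_)
open import Function.Bundles using (module Equivalence)
open import Relation.Binary.Construct.Closure.ReflexiveTransitive using (ε; _◅_)
open import Relation.Binary.PropositionalEquality using (_≡_; refl; sym; trans; cong; subst)
open import Relation.Nullary using (Dec; yes; no)
open import Relation.Nullary.Decidable using (isYes; toWitness; _⊎-dec_; _→-dec_)

open import Defs using (Configuration; module Pebbling)

all-below : ∀ {n} {P : Vec ℕ n → Set} → Vec ℕ n → (∀ t → Dec (P t)) → Bool
all-below []       P? = isYes (P? [])
all-below (c ∷ cs) P? = all (λ k → all-below cs (λ t → P? (k ∷ t))) (upTo c)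

-- The certificate is taken as an equation rather than as T (all-below cs P?): passing a
-- proof of T b makes Agda reduce its type, which would re-run the whole check.
all-below-sound : ∀ {n} {P : Vec ℕ n → Set} (cs : Vec ℕ n) (P? : ∀ t → Dec (P t)) →
                  all-below cs P? ≡ true → ∀ {t} → Pointwise _<_ t cs → P t
all-below-sound []       P? ok []           = toWitness (Equivalence.from T-≡ ok)
all-below-sound (c ∷ cs) P? ok (k<c ∷ t<cs) = all-below-sound cs (λ t → P? (_ ∷ t)) ok′ t<cs
  where
  ok′ : all-below cs (λ t → P? (_ ∷ t)) ≡ true
  ok′ = Equivalence.to T-≡ (All.lookup (all⁺ _ (upTo c) (Equivalence.from T-≡ ok)) (∈-upTo⁺ k<c))

all-found : {A : Set} {P : A → Set} (find : (a : A) → Maybe (P a)) (as : List A) →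
            T (all (is-just ∘ find) as) → All P as
all-found find as found = All.map (λ {a} → to-witness-T (find a)) (all⁺ (is-just ∘ find) as found)

module PebblingProperties {V : Set} (_≟_ : (x y : V) → Dec (x ≡ y))
                          (Adj : V → V → Set) (vs : List V) where

  open Pebbling _≟_ Adj vs

  infix 4 _≼_
  _≼_ : Configuration V → Configuration V → Set
  p ≼ q = ∀ x → p x ≤ q x

  fire : V → V → Configuration V → Configuration V
  fire u v p x = (p x ∸ 2 * [ x == u ]) + [ x == v ]

  fire-mono : ∀ u v {p q} → p ≼ q → fire u v p ≼ fire u v q
  fire-mono u v p≼q x = +-monoˡ-≤ [ x == v ] (∸-monoˡ-≤ (2 * [ x == u ]) (p≼q x))

  fire-move : ∀ {u v p} → Adj u v → 2 ≤ p u → Move p (fire u v p)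
  fire-move {u} {v} adj 2≤pu = u , v , adj , 2≤pu , λ _ → refl

  move-mono : ∀ {p q p₁} → p ≼ q → Move p p₁ → ∃ λ q₁ → Move q q₁ × p₁ ≼ q₁
  move-mono {q = q} p≼q (u , v , adj , 2≤pu , p₁≡) =
    fire u v q , fire-move adj (≤-trans 2≤pu (p≼q u)) ,
    λ x → subst (_≤ fire u v q x) (sym (p₁≡ x)) (fire-mono u v p≼q x)

  reachable-mono : ∀ {p q p′} → p ≼ q → Reachable p p′ → ∃ λ q′ → Reachable q q′ × p′ ≼ q′
  reachable-mono p≼q ε = _ , ε , p≼q
  reachable-mono p≼q (move ◅ moves)
    with _ , move′ , p₁≼q₁ ← move-mono p≼q move
    with q′ , moves′ , p′≼q′ ← reachable-mono p₁≼q₁ moves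
    = q′ , move′ ◅ moves′ , p′≼q′

  solvable-mono : ∀ {r p q} → p ≼ q → Solvable r p → Solvable r q
  solvable-mono {r} p≼q (p′ , moves , 1≤p′r)
    with q′ , moves′ , p′≼q′ ← reachable-mono p≼q moves
    = q′ , moves′ , ≤-trans 1≤p′r (p′≼q′ r)

  pile : V → ℕ → Configuration V
  pile x c y = c * [ y == x ]

  pile-≼ : ∀ {x c p} → c ≤ p x → pile x c ≼ p
  pile-≼ {x} {c} {p} c≤px y with y ≟ x
  ... | yes refl = subst (_≤ p y) (sym (*-identityʳ c)) c≤px
  ... | no _     = subst (_≤ p y) (sym (*-zeroʳ c)) z≤n

  unsolvable-< : ∀ {r p x c} → Unsolvable r p → Solvable r (pile x c) → p x < c
  unsolvable-< {p = p} {x} {c} unsolvable solvable with c ≤? p x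
  ... | yes c≤px = ⊥-elim (unsolvable (solvable-mono (pile-≼ c≤px) solvable))
  ... | no c≰px  = ≰⇒> c≰px

  module Search (adj? : ∀ u v → Dec (Adj u v)) (r : V) where

    search : ℕ → (p : Configuration V) → Maybe (Solvable r p)
    search n p with 1 ≤? p r
    ... | yes 1≤pr = just (p , ε , 1≤pr)
    search ℕ.zero    p | no _ = nothing
    search (ℕ.suc n) p | no _ = foldr _<∣>_ nothing (map try (cartesianProduct vs vs))
      where
      try : V × V → Maybe (Solvable r p)
      try (u , v) with 2 ≤? p u | adj? u v
      ... | yes 2≤pu | yes adj =
        Maybe.map (λ (q , moves , 1≤qr) → q , fire-move adj 2≤pu ◅ moves , 1≤qr) (search n (fire u v p))
      ... | _ | _ = nothing

open Defs
open PebblingProperties _≟Q3_ AdjQ3 verticesQ3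
open Search (λ u v → hamming u v ≟ℕ 1) rootQ3

vertices : Vec Q3 8
vertices = fromList verticesQ3

index : Q3 → Fin 8
index (false ∷ false ∷ false ∷ []) = zero
index (true  ∷ false ∷ false ∷ []) = suc zero
index (false ∷ true  ∷ false ∷ []) = suc (suc zero)
index (false ∷ false ∷ true  ∷ []) = suc (suc (suc zero))
index (true  ∷ true  ∷ false ∷ []) = suc (suc (suc (suc zero)))
index (true  ∷ false ∷ true  ∷ []) = suc (suc (suc (suc (suc zero))))
index (false ∷ true  ∷ true  ∷ []) = suc (suc (suc (suc (suc (suc zero)))))
index (true  ∷ true  ∷ true  ∷ []) = suc (suc (suc (suc (suc (suc (suc zero))))))

lookup-index : ∀ x → lookup vertices (index x) ≡ x
lookup-index (false ∷ false ∷ false ∷ []) = refl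
lookup-index (true  ∷ false ∷ false ∷ []) = refl
lookup-index (false ∷ true  ∷ false ∷ []) = refl
lookup-index (false ∷ false ∷ true  ∷ []) = refl
lookup-index (true  ∷ true  ∷ false ∷ []) = refl
lookup-index (true  ∷ false ∷ true  ∷ []) = refl
lookup-index (false ∷ true  ∷ true  ∷ []) = refl
lookup-index (true  ∷ true  ∷ true  ∷ []) = refl

∀-vertex : {P : Q3 → Set} → All P verticesQ3 → ∀ x → P x
∀-vertex {P} all x = subst P (lookup-index x) (lookup⁺ (fromList⁺ all) (index x))

-- Tuples list the pebbles on the vertices in the order of verticesQ3: the root, the three
-- vertices of weight 2, the three of weight 4/3, then (1,1,1).
conf : Vec ℕ 8 → Configuration Q3
conf t x = lookup t (index x)

tuple : Configuration Q3 → Vec ℕ 8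
tuple p = Vec.map p vertices

conf-tuple : ∀ p x → conf (tuple p) x ≡ p x
conf-tuple p x = trans (lookup-map (index x) p vertices) (cong p (lookup-index x))

conf-mono : ∀ {m t} → Pointwise _≤_ m t → conf m ≼ conf t
conf-mono m≤t x = Pointwise.lookup m≤t (index x)

cap : Q3 → ℕ
cap x = 2 ^ ones x

pile-cap-solvable : ∀ x → Solvable rootQ3 (pile x (cap x))
pile-cap-solvable = ∀-vertex (all-found (λ x → search 7 (pile x (cap x))) verticesQ3 _)

caps : Vec ℕ 8
caps = Vec.map cap vertices

tuple-< : ∀ {p} → (∀ x → p x < cap x) → Pointwise _<_ (tuple p) caps
tuple-< {p} p<cap = Pointwise.map⁺ {_∼₁_ = _≡_} {f = p} {g = cap} (λ { refl → p<cap _ }) (Pointwise.refl refl)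

-- Found by computer search: each configuration of the box whose weight exceeds w′(1_G)
-- dominates one of these.
solvable-tuples : List (Vec ℕ 8)
solvable-tuples =
  (0 ∷ 0 ∷ 0 ∷ 0 ∷ 0 ∷ 0 ∷ 3 ∷ 2 ∷ []) ∷
  (0 ∷ 0 ∷ 0 ∷ 0 ∷ 0 ∷ 1 ∷ 0 ∷ 6 ∷ []) ∷
  (0 ∷ 0 ∷ 0 ∷ 0 ∷ 0 ∷ 1 ∷ 1 ∷ 4 ∷ []) ∷
  (0 ∷ 0 ∷ 0 ∷ 0 ∷ 0 ∷ 2 ∷ 2 ∷ 0 ∷ []) ∷
  (0 ∷ 0 ∷ 0 ∷ 0 ∷ 0 ∷ 3 ∷ 0 ∷ 2 ∷ []) ∷
  (0 ∷ 0 ∷ 0 ∷ 0 ∷ 2 ∷ 0 ∷ 0 ∷ 4 ∷ []) ∷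
  (0 ∷ 0 ∷ 0 ∷ 1 ∷ 0 ∷ 0 ∷ 1 ∷ 2 ∷ []) ∷
  (0 ∷ 0 ∷ 0 ∷ 1 ∷ 0 ∷ 0 ∷ 2 ∷ 0 ∷ []) ∷
  (0 ∷ 0 ∷ 0 ∷ 1 ∷ 0 ∷ 2 ∷ 0 ∷ 0 ∷ []) ∷
  (0 ∷ 0 ∷ 1 ∷ 0 ∷ 0 ∷ 0 ∷ 0 ∷ 4 ∷ []) ∷
  (0 ∷ 0 ∷ 1 ∷ 0 ∷ 0 ∷ 0 ∷ 2 ∷ 0 ∷ []) ∷
  (0 ∷ 0 ∷ 1 ∷ 0 ∷ 0 ∷ 2 ∷ 1 ∷ 1 ∷ []) ∷
  (0 ∷ 0 ∷ 1 ∷ 0 ∷ 1 ∷ 0 ∷ 0 ∷ 2 ∷ []) ∷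
  (0 ∷ 0 ∷ 1 ∷ 0 ∷ 2 ∷ 0 ∷ 0 ∷ 0 ∷ []) ∷
  (0 ∷ 1 ∷ 0 ∷ 0 ∷ 0 ∷ 0 ∷ 0 ∷ 4 ∷ []) ∷
  (0 ∷ 1 ∷ 0 ∷ 0 ∷ 2 ∷ 0 ∷ 0 ∷ 0 ∷ []) ∷
  []

solvable-tuples-solvable : All (Solvable rootQ3 ∘ conf) solvable-tuples
solvable-tuples-solvable = all-found (search 7 ∘ conf) solvable-tuples _

Covered : Vec ℕ 8 → Set
Covered t = weight w′ (conf t) ≤ℚ weight w′ one ⊎ Any (λ m → Pointwise _≤_ m t) solvable-tuples

covered? : ∀ t → Dec (Covered t)
covered? t = (weight w′ (conf t) ≤ℚ? weight w′ one) ⊎-dec any? (λ m → Pointwise.decidable _≤?_ m t) solvable-tuples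

covered-certificate : all-below caps covered? ≡ true
covered-certificate = refl

unsolvable-covered : ∀ {p} → Unsolvable rootQ3 p → Covered (tuple p)
unsolvable-covered {p} unsolvable =
  all-below-sound caps covered? covered-certificate {tuple p}
    (tuple-< λ x → unsolvable-< unsolvable (pile-cap-solvable x))

dominating-solvable : ∀ {t} → Any (λ m → Pointwise _≤_ m t) solvable-tuples → Solvable rootQ3 (conf t)
dominating-solvable = All.lookupWith (λ m-solvable m≤t → solvable-mono (conf-mono m≤t) m-solvable)
                                     solvable-tuples-solvable

-- Holds by computation: weight evaluates a configuration only at the listed vertices,
-- where conf (tuple p) reduces to p.
weight-tuple : ∀ p → weight w′ (conf (tuple p)) ≡ weight w′ p
weight-tuple p = refl

unsolvable-weight : ∀ p → Unsolvable rootQ3 p → weight w′ p ≤ℚ weight w′ one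
unsolvable-weight p unsolvable = [ light , dominating ]′ (unsolvable-covered unsolvable)
  where
  light : weight w′ (conf (tuple p)) ≤ℚ weight w′ one → weight w′ p ≤ℚ weight w′ one
  light = subst (_≤ℚ weight w′ one) (weight-tuple p)

  dominating : Any (λ m → Pointwise _≤_ m (tuple p)) solvable-tuples → weight w′ p ≤ℚ weight w′ one
  dominating m≤tuple = ⊥-elim (unsolvable
    (solvable-mono {p = conf (tuple p)} {p} (≤-reflexive ∘ conf-tuple p) (dominating-solvable m≤tuple)))

proposition2 : ValidWeight rootQ3 w′
proposition2 =
  ∀-vertex (toWitness {a? = all? (λ v → 0ℚ ≤ℚ? w′ v) verticesQ3} _) ,
  refl ,
  ∀-vertex (toWitness {a? = all? (λ v → (w′ v ≟ℚ 0ℚ) →-dec (v ≟Q3 rootQ3)) verticesQ3} _) ,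
  unsolvable-weight
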